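{- Let $R$ be a finite commutative ring with unity such that every residue field of $R$ has odd characteristic. Then $$\chi(Reg(\Gamma(R)))=\omega(Reg(\Gamma(R)))=2^{|{\rm Max}(R)|}.$$
   Context: $Z(R)$ is the set of zero-divisors of $R$ (including $0$), ${\rm Reg}(R)=R\setminus Z(R)$ the set of regular elements, ${\rm Max}(R)$ the set of maximal ideals; residue fields are $R/\mathfrak{m}$, $\mathfrak{m}\in{\rm Max}(R)$. The total graph $T(\Gamma(R))$ has vertex set $R$, distinct $x,y$ adjacent iff $x+y\in Z(R)$; $Reg(\Gamma(R))$ is its induced subgraph on ${\rm Reg}(R)$. $\chi$ is chromatic number, $\omega$ clique number. -}

module Defs where

open import Level using (Level; _⊔_)
open import Data.Nat using (ℕ; zero; suc; _<_; _≤_; _%_)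
open import Data.Fin using (Fin)
open import Data.Bool using (Bool; true)
open import Data.Product using (Σ; _×_; ∃)
open import Data.Sum using (_⊎_)
open import Relation.Nullary using (¬_)
open import Relation.Binary.PropositionalEquality using (_≡_)
import Relation.Binary.PropositionalEquality as ≡
open import Function.Bundles using (Inverse)
open import Algebra.Bundles using (CommutativeRing)

Finite : ∀ {c ℓ} → CommutativeRing c ℓ → Set (c ⊔ ℓ)
Finite R = Σ ℕ λ n → Inverse (≡.setoid (Fin n)) (CommutativeRing.setoid R)

module _ {c ℓ} (R : CommutativeRing c ℓ) where
  open CommutativeRing R

  ZeroDiv : Carrier → Set (c ⊔ ℓ)
  ZeroDiv x = ∃ λ y → ¬ (y ≈ 0#) × (x * y ≈ 0#)

  Regular : Carrier → Set (c ⊔ ℓ)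
  Regular x = ¬ ZeroDiv x

  -- Adjacency in the total graph T(Γ(R)): distinct vertices whose sum is a zero-divisor.
  Adj : Carrier → Carrier → Set (c ⊔ ℓ)
  Adj x y = ¬ (x ≈ y) × ZeroDiv (x + y)

  Subset : Set c
  Subset = Carrier → Bool

  _∈_ : Carrier → Subset → Set
  x ∈ S = S x ≡ true

  _⊆_ : Subset → Subset → Set c
  S ⊆ T = ∀ x → x ∈ S → x ∈ T

  SameSet : Subset → Subset → Set c
  SameSet S T = ∀ x → S x ≡ T x

  record IsIdeal (I : Subset) : Set (c ⊔ ℓ) where
    field
      resp  : ∀ {x y} → x ≈ y → I x ≡ I y
      zero∈ : 0# ∈ I
      +-closed : ∀ {x y} → x ∈ I → y ∈ I → (x + y) ∈ I
      *-closed : ∀ r {x} → x ∈ I → (r * x) ∈ I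

  record IsMaximal (M : Subset) : Set (c ⊔ ℓ) where
    field
      ideal  : IsIdeal M
      proper : ¬ (1# ∈ M)
      maximal : ∀ J → IsIdeal J → M ⊆ J → (J ⊆ M) ⊎ (1# ∈ J)

  NumMaximal : ℕ → Set (c ⊔ ℓ)
  NumMaximal k = Σ (Fin k → Subset) λ M →
      (∀ i → IsMaximal (M i))
    × (∀ i j → SameSet (M i) (M j) → i ≡ j)
    × (∀ I → IsMaximal I → ∃ λ i → SameSet I (M i))

  natR : ℕ → Carrier
  natR zero = 0#
  natR (suc n) = 1# + natR n

  -- the residue field R/M has characteristic n (least positive n with n·1 = 0 in R/M)
  IsCharOf : Subset → ℕ → Set
  IsCharOf M n = (0 < n) × (natR n ∈ M) × (∀ k → 0 < k → k < n → ¬ (natR k ∈ M))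

  -- Graph Reg(Γ(R)): induced subgraph of T(Γ(R)) on Reg(R).
  -- A proper colouring with k colours.
  ProperColouring : ℕ → Set (c ⊔ ℓ)
  ProperColouring k = Σ (Carrier → Fin k) λ col →
    ∀ x y → Regular x → Regular y → Adj x y → ¬ (col x ≡ col y)

  Clique : ℕ → Set (c ⊔ ℓ)
  Clique k = Σ (Fin k → Carrier) λ f →
      (∀ i → Regular (f i))
    × (∀ i j → f i ≈ f j → i ≡ j)
    × (∀ i j → ¬ (i ≡ j) → Adj (f i) (f j))

  ChromaticNumberReg : ℕ → Set (c ⊔ ℓ)
  ChromaticNumberReg n = ProperColouring n × (∀ m → ProperColouring m → n ≤ m)

  CliqueNumberReg : ℕ → Set (c ⊔ ℓ)
  CliqueNumberReg n = Clique n × (∀ m → Clique m → m ≤ n)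

Odd : ℕ → Set
Odd n = n % 2 ≡ 1

-- Let M₁, …, M_k be the maximal ideals. In a finite ring the zero divisors are exactly the elements of
-- M₁ ∪ … ∪ M_k, so regular x, y are adjacent iff x + y ∈ M_i for some i. As 2 ∉ M_i, a regular x has
-- distinct cosets x + M_i and −x + M_i, and x + y ∈ M_i exchanges them for y; so colouring x by which of
-- the two comes first in a fixed enumeration, for every i, is a proper 2^k-colouring. Conversely, by the
-- Chinese remainder theorem there is for each sign vector ε an element ≡ ε_i (mod M_i) for all i; these
-- 2^k elements are regular and pairwise adjacent. A clique is never larger than a colouring.
module Submission where

open import Defs hiding (_∈_; _⊆_)
open import Algebra.Bundles using (CommutativeRing)
open import Data.Nat as ℕ using (ℕ; zero; suc; _^_; _≤_; _<_; z≤n; s≤s)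
import Data.Nat.Properties as ℕ
open import Data.Fin using (Fin; zero; suc; funToFin; finToFun; punchOut)
import Data.Fin.Properties as Fin
import Data.Fin.Subset as FinSubset
import Data.Fin.Subset.Properties as FinSubset
import Data.Vec as Vec
import Data.Vec.Properties as Vec
open import Data.Bool using (Bool; true; false; if_then_else_)
import Data.Bool.Properties as Bool
open import Data.Maybe as Maybe using (Maybe; just; nothing)
open import Data.Product using (∃; _×_; _,_; proj₁; proj₂)
open import Data.Sum using (_⊎_; inj₁; inj₂; [_,_]′)
open import Function using (_∘_)
open import Function.Bundles using (Inverse; mk⇔)
open import Function.Definitions using (Injective)
open import Relation.Binary using (Decidable; tri<; tri≈; tri>)
open import Relation.Nullary using (¬_; Dec; yes; no; does; ¬?; _×-dec_; contradiction)
open import Relation.Nullary.Decidable using (dec-true; map′; decidable-stable)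
open import Relation.Binary.PropositionalEquality as ≡ using (_≡_; _≢_; _≗_)

does⇒ : ∀ {p} {P : Set p} (P? : Dec P) → does P? ≡ true → P
does⇒ (yes p) _ = p

firstTrue : ∀ {n} → (Fin n → Bool) → Maybe (Fin n)
firstTrue {zero}  p = nothing
firstTrue {suc n} p = if p zero then just zero else Maybe.map suc (firstTrue (p ∘ suc))

firstTrue-cong : ∀ {n} {p q : Fin n → Bool} → p ≗ q → firstTrue p ≡ firstTrue q
firstTrue-cong {zero}  eq = ≡.refl
firstTrue-cong {suc n} eq =
  ≡.cong₂ (λ b m → if b then just zero else Maybe.map suc m) (eq zero) (firstTrue-cong (eq ∘ suc))

firstTrue-sound : ∀ {n} (p : Fin n → Bool) {i} → firstTrue p ≡ just i → p i ≡ true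
firstTrue-sound {suc n} p eq with p zero in p₀ | firstTrue (p ∘ suc) in rest
firstTrue-sound {suc n} p ≡.refl | true  | _      = p₀
firstTrue-sound {suc n} p ≡.refl | false | just i = firstTrue-sound (p ∘ suc) rest

firstTrue-complete : ∀ {n} (p : Fin n → Bool) {j} → p j ≡ true → ∃ λ i → firstTrue p ≡ just i
firstTrue-complete {suc n} p {j} pj with p zero in p₀
... | true = zero , ≡.refl
firstTrue-complete {suc n} p {zero}  pj | false = contradiction (≡.trans (≡.sym p₀) pj) λ ()
firstTrue-complete {suc n} p {suc j} pj | false with firstTrue-complete (p ∘ suc) pj
... | i , eq rewrite eq = suc i , ≡.refl

injective⇒surjective : ∀ {n} (f : Fin n → Fin n) → Injective _≡_ _≡_ f → ∀ y → ∃ λ j → f j ≡ y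
injective⇒surjective f f-inj y with Fin.any? (λ j → f j Fin.≟ y)
... | yes hit = hit
injective⇒surjective {suc m} f f-inj y | no miss =
  contradiction (Fin.injective⇒≤ squeeze-injective) ℕ.1+n≰n
  where
  avoids : ∀ j → y ≢ f j
  avoids j y≡fj = miss (j , ≡.sym y≡fj)

  squeeze : Fin (suc m) → Fin m
  squeeze j = punchOut (avoids j)

  squeeze-injective : Injective _≡_ _≡_ squeeze
  squeeze-injective eq = f-inj (Fin.punchOut-injective (avoids _) (avoids _) eq)

funToFin-cong : ∀ {m k} {f g : Fin m → Fin k} → f ≗ g → funToFin f ≡ funToFin g
funToFin-cong {zero}  eq = ≡.refl
funToFin-cong {suc m} eq = ≡.cong₂ Data.Fin.combine (eq zero) (funToFin-cong (eq ∘ suc))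

funToFin-injective : ∀ {m k} {f g : Fin m → Fin k} → funToFin f ≡ funToFin g → f ≗ g
funToFin-injective {f = f} {g} eq i = ≡.trans (≡.sym (Fin.finToFun-funToFin f i))
  (≡.trans (≡.cong (λ a → finToFun a i) eq) (Fin.finToFun-funToFin g i))

finToFun-injective : ∀ {m n} {a b : Fin (m ^ n)} → finToFun {m} {n} a ≗ finToFun b → a ≡ b
finToFun-injective {m} {n} {a} {b} eq = ≡.trans (≡.sym (Fin.funToFin-finToFin {n} {m} a))
  (≡.trans (funToFin-cong eq) (Fin.funToFin-finToFin {n} {m} b))

∈-tabulate⁺ : ∀ {n} {f : Fin n → Bool} {j} → f j ≡ true → j FinSubset.∈ Vec.tabulate f
∈-tabulate⁺ {f = f} {j} fj = Vec.lookup⇒[]= j _ (≡.trans (Vec.lookup∘tabulate f j) fj)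

∈-tabulate⁻ : ∀ {n} {f : Fin n → Bool} {j} → j FinSubset.∈ Vec.tabulate f → f j ≡ true
∈-tabulate⁻ {f = f} {j} j∈ = ≡.trans (≡.sym (Vec.lookup∘tabulate f j)) (Vec.[]=⇒lookup j∈)

order : ∀ {n} → Fin n → Fin n → Fin 2
order a b with Fin.<-cmp a b
... | tri< _ _ _ = zero
... | tri≈ _ _ _ = zero
... | tri> _ _ _ = suc zero

order-swap : ∀ {n} {a b : Fin n} → a ≢ b → order a b ≢ order b a
order-swap {a = a} {b} a≢b with Fin.<-cmp a b | Fin.<-cmp b a
... | tri< _ _ _     | tri> _ _ _     = λ ()
... | tri> _ _ _     | tri< _ _ _     = λ ()
... | tri≈ _ a≡b _   | _              = contradiction a≡b a≢b
... | _              | tri≈ _ b≡a _   = contradiction (≡.sym b≡a) a≢b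
... | tri< a<b _ _   | tri< b<a _ _   = contradiction b<a (Fin.<-asym a<b)
... | tri> _ _ b<a   | tri> _ _ a<b   = contradiction b<a (Fin.<-asym a<b)

orient : ∀ {n} → Maybe (Fin n) → Maybe (Fin n) → Fin 2
orient (just a) (just b) = order a b
orient _        _        = zero

module Ideals {c ℓ} (R : CommutativeRing c ℓ) where
  open CommutativeRing R hiding (zero)
  open import Algebra.Properties.Ring ring using (-1*x≈-x; x[y-z]≈xy-xz; [y-z]x≈yx-zx)
  open import Algebra.Properties.AbelianGroup +-abelianGroup
    using (⁻¹-anti-homo‿-; ⁻¹-∙-comm; ⁻¹-involutive; ε⁻¹≈ε; x≈y⇒x∙y⁻¹≈ε)
  open import Algebra.Properties.CommutativeSemigroup +-commutativeSemigroup using (interchange)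
  open import Algebra.Definitions.RawMonoid +-rawMonoid public using (sum)
  open import Algebra.Definitions.RawMonoid *-rawMonoid public using () renaming (sum to product)
  open import Relation.Binary.Reasoning.Setoid setoid

  infix 4 _∈_ _⊆_ _≋_mod_

  _∈_ : Carrier → Subset R → Set
  x ∈ I = I x ≡ true

  _⊆_ : Subset R → Subset R → Set c
  I ⊆ J = ∀ x → x ∈ I → x ∈ J

  _≋_mod_ : Carrier → Carrier → Subset R → Set
  x ≋ y mod I = x - y ∈ I

  x-0≈x : ∀ x → x - 0# ≈ x
  x-0≈x x = trans (+-congˡ ε⁻¹≈ε) (+-identityʳ x)

  [x-y]+[y-z]≈x-z : ∀ x y z → (x - y) + (y - z) ≈ x - z
  [x-y]+[y-z]≈x-z x y z = begin
    (x - y) + (y - z)  ≈⟨ +-assoc x (- y) (y - z) ⟩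
    x + (- y + (y - z)) ≈⟨ +-congˡ (+-assoc (- y) y (- z)) ⟨
    x + ((- y + y) - z) ≈⟨ +-congˡ (+-congʳ (-‿inverseˡ y)) ⟩
    x + (0# - z)       ≈⟨ +-congˡ (+-identityˡ (- z)) ⟩
    x - z              ∎

  [x+y]-[u+v]≈[x-u]+[y-v] : ∀ x y u v → (x + y) - (u + v) ≈ (x - u) + (y - v)
  [x+y]-[u+v]≈[x-u]+[y-v] x y u v =
    trans (+-congˡ (sym (⁻¹-∙-comm u v))) (interchange x y (- u) (- v))

  xy-uv≈x[y-v]+[x-u]v : ∀ x y u v → x * y - u * v ≈ x * (y - v) + (x - u) * v
  xy-uv≈x[y-v]+[x-u]v x y u v = sym (begin
    x * (y - v) + (x - u) * v           ≈⟨ +-cong (x[y-z]≈xy-xz x y v) ([y-z]x≈yx-zx v x u) ⟩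
    (x * y - x * v) + (x * v - u * v)   ≈⟨ [x-y]+[y-z]≈x-z (x * y) (x * v) (u * v) ⟩
    x * y - u * v                       ∎)

  ⊆-antisym : ∀ {I J} → I ⊆ J → J ⊆ I → SameSet R I J
  ⊆-antisym I⊆J J⊆I x = Bool.⇔→≡ (mk⇔ (I⊆J x) (J⊆I x))

  sign : Fin 2 → Carrier
  sign zero       = 1#
  sign (suc zero) = - 1#

  sign-opposite : ∀ {s t} → s ≢ t → sign s + sign t ≈ 0#
  sign-opposite {zero}     {zero}     s≢t = contradiction ≡.refl s≢t
  sign-opposite {zero}     {suc zero} _   = -‿inverseʳ 1#
  sign-opposite {suc zero} {zero}     _   = -‿inverseˡ 1#
  sign-opposite {suc zero} {suc zero} s≢t = contradiction ≡.refl s≢t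

  zeroDivisor⇒¬invertible : ∀ {x r} → ZeroDiv R x → ¬ x * r ≈ 1#
  zeroDivisor⇒¬invertible {x} {r} (y , y≉0 , xy≈0) xr≈1 = y≉0 (begin
    y            ≈⟨ *-identityˡ y ⟨
    1# * y       ≈⟨ *-congʳ xr≈1 ⟨
    (x * r) * y  ≈⟨ *-congʳ (*-comm x r) ⟩
    (r * x) * y  ≈⟨ *-assoc r x y ⟩
    r * (x * y)  ≈⟨ *-congˡ xy≈0 ⟩
    r * 0#       ≈⟨ zeroʳ r ⟩
    0#           ∎)

  module Ideal {I : Subset R} (isI : IsIdeal R I) where
    open IsIdeal isI

    ∈-resp-≈ : ∀ {x y} → x ≈ y → x ∈ I → y ∈ I
    ∈-resp-≈ x≈y x∈I = ≡.trans (≡.sym (resp x≈y)) x∈I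

    *ʳ-closed : ∀ {x} r → x ∈ I → x * r ∈ I
    *ʳ-closed r x∈I = ∈-resp-≈ (*-comm r _) (*-closed r x∈I)

    -‿closed : ∀ {x} → x ∈ I → - x ∈ I
    -‿closed x∈I = ∈-resp-≈ (-1*x≈-x _) (*-closed (- 1#) x∈I)

    ≋-reflexive : ∀ {x y} → x ≈ y → x ≋ y mod I
    ≋-reflexive x≈y = ∈-resp-≈ (sym (x≈y⇒x∙y⁻¹≈ε x≈y)) zero∈

    ≋-refl : ∀ {x} → x ≋ x mod I
    ≋-refl = ≋-reflexive refl

    ≋-sym : ∀ {x y} → x ≋ y mod I → y ≋ x mod I
    ≋-sym {x} {y} x≋y = ∈-resp-≈ (⁻¹-anti-homo‿- x y) (-‿closed x≋y)

    ≋-trans : ∀ {x y z} → x ≋ y mod I → y ≋ z mod I → x ≋ z mod I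
    ≋-trans {x} {y} {z} x≋y y≋z = ∈-resp-≈ ([x-y]+[y-z]≈x-z x y z) (+-closed x≋y y≋z)

    ≋-neg : ∀ {x y} → x ≋ y mod I → - x ≋ - y mod I
    ≋-neg {x} {y} x≋y = ∈-resp-≈ (sym (⁻¹-∙-comm x (- y))) (-‿closed x≋y)

    ≋-+ : ∀ {x y u v} → x ≋ u mod I → y ≋ v mod I → x + y ≋ u + v mod I
    ≋-+ {x} {y} {u} {v} x≋u y≋v =
      ∈-resp-≈ (sym ([x+y]-[u+v]≈[x-u]+[y-v] x y u v)) (+-closed x≋u y≋v)

    ≋-* : ∀ {x y u v} → x ≋ u mod I → y ≋ v mod I → x * y ≋ u * v mod I
    ≋-* {x} {y} {u} {v} x≋u y≋v =
      ∈-resp-≈ (sym (xy-uv≈x[y-v]+[x-u]v x y u v)) (+-closed (*-closed x y≋v) (*ʳ-closed v x≋u))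

    ∈⇒≋0 : ∀ {x} → x ∈ I → x ≋ 0# mod I
    ∈⇒≋0 {x} = ∈-resp-≈ (sym (x-0≈x x))

    ≋0⇒∈ : ∀ {x} → x ≋ 0# mod I → x ∈ I
    ≋0⇒∈ {x} = ∈-resp-≈ (x-0≈x x)

    ∈-resp-≋ : ∀ {x y} → x ≋ y mod I → x ∈ I → y ∈ I
    ∈-resp-≋ x≋y x∈I = ≋0⇒∈ (≋-trans (≋-sym x≋y) (∈⇒≋0 x∈I))

    membership-resp-≋ : ∀ {x y} → x ≋ y mod I → I x ≡ I y
    membership-resp-≋ x≋y = Bool.⇔→≡ (mk⇔ (∈-resp-≋ x≋y) (∈-resp-≋ (≋-sym x≋y)))

    sign∉ : ¬ 1# ∈ I → ∀ s → ¬ sign s ∈ I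
    sign∉ 1∉I zero       = 1∉I
    sign∉ 1∉I (suc zero) = 1∉I ∘ ∈-resp-≈ (⁻¹-involutive 1#) ∘ -‿closed

    sum-∈ : ∀ {k} (f : Fin k → Carrier) → (∀ i → f i ∈ I) → sum f ∈ I
    sum-∈ {zero}  f all∈ = zero∈
    sum-∈ {suc k} f all∈ = +-closed (all∈ zero) (sum-∈ (f ∘ suc) (all∈ ∘ suc))

    sum-≋-single : ∀ {k} (f : Fin k → Carrier) j {x} → f j ≋ x mod I →
                   (∀ i → i ≢ j → f i ∈ I) → sum f ≋ x mod I
    sum-≋-single {suc k} f zero {x} fj≋x others∈ =
      ≋-trans (≋-+ fj≋x (∈⇒≋0 (sum-∈ (f ∘ suc) (λ i → others∈ (suc i) λ ()))))
              (≋-reflexive (+-identityʳ x))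
    sum-≋-single {suc k} f (suc j) {x} fj≋x others∈ =
      ≋-trans (≋-+ (∈⇒≋0 (others∈ zero λ ()))
                   (sum-≋-single (f ∘ suc) j fj≋x (λ i i≢j → others∈ (suc i) (i≢j ∘ Fin.suc-injective))))
              (≋-reflexive (+-identityˡ x))

    product-≋1 : ∀ {k} (f : Fin k → Carrier) → (∀ i → f i ≋ 1# mod I) → product f ≋ 1# mod I
    product-≋1 {zero}  f all≋1 = ≋-refl
    product-≋1 {suc k} f all≋1 =
      ≋-trans (≋-* (all≋1 zero) (product-≋1 (f ∘ suc) (all≋1 ∘ suc))) (≋-reflexive (*-identityʳ 1#))

    product-∈ : ∀ {k} (f : Fin k → Carrier) j → f j ∈ I → product f ∈ I
    product-∈ {suc k} f zero    fj∈I = *ʳ-closed _ fj∈I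
    product-∈ {suc k} f (suc j) fj∈I = *-closed (f zero) (product-∈ (f ∘ suc) j fj∈I)

  oddCharacteristic⇒2∉ : ∀ {M} → IsMaximal R M → (∀ m → IsCharOf R M m → Odd m) → ¬ 1# + 1# ∈ M
  oddCharacteristic⇒2∉ {M} isM odd 2∈M = contradiction (odd 2 (s≤s z≤n , 2∈M′ , below2)) λ ()
    where
    open IsMaximal isM
    open Ideal ideal

    2∈M′ : natR R 2 ∈ M
    2∈M′ = ∈-resp-≈ (+-congˡ (sym (+-identityʳ 1#))) 2∈M

    below2 : ∀ m → 0 < m → m < 2 → ¬ natR R m ∈ M
    below2 1 _ _ = proper ∘ ∈-resp-≈ (+-identityʳ 1#)
    below2 (suc (suc _)) _ (s≤s (s≤s ()))

clique≤colours : ∀ {c ℓ} (R : CommutativeRing c ℓ) {m m′} → Clique R m → ProperColouring R m′ → m ≤ m′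
clique≤colours R (v , regular , _ , adjacent) (colour , proper) = Fin.injective⇒≤ colour∘v-injective
  where
  colour∘v-injective : Injective _≡_ _≡_ (colour ∘ v)
  colour∘v-injective {a} {b} same with a Fin.≟ b
  ... | yes a≡b = a≡b
  ... | no a≢b  = contradiction same (proper _ _ (regular a) (regular b) (adjacent a b a≢b))

colouring×clique⇒χ≡ω : ∀ {c ℓ} (R : CommutativeRing c ℓ) {m} → ProperColouring R m → Clique R m →
                        ChromaticNumberReg R m × CliqueNumberReg R m
colouring×clique⇒χ≡ω R colouring clique =
  (colouring , λ _ colouring′ → clique≤colours R clique colouring′) ,
  (clique , λ _ clique′ → clique≤colours R clique′ colouring)

module FiniteRing {c ℓ} (R : CommutativeRing c ℓ) {n : ℕ}
                  (enum : Inverse (≡.setoid (Fin n)) (CommutativeRing.setoid R)) where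
  open CommutativeRing R hiding (zero)
  open Ideals R
  open Inverse enum using (to; from; to-cong; from-cong; strictlyInverseˡ; strictlyInverseʳ)
  open import Algebra.Properties.Ring ring using (x[y-z]≈xy-xz)
  open import Algebra.Properties.AbelianGroup +-abelianGroup using (x∙y⁻¹≈ε⇒x≈y; x≈y⇒x∙y⁻¹≈ε; ⁻¹-involutive)
  open import Algebra.Properties.CommutativeSemigroup *-commutativeSemigroup using (x∙yz≈y∙xz)

  to∘from : ∀ x → to (from x) ≈ x
  to∘from = strictlyInverseˡ

  from-injective : ∀ {x y} → from x ≡ from y → x ≈ y
  from-injective {x} {y} eq = trans (sym (to∘from x)) (trans (to-cong eq) (to∘from y))

  to-injective : ∀ {i j} → to i ≈ to j → i ≡ j
  to-injective {i} {j} to-i≈to-j =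
    ≡.trans (≡.sym (strictlyInverseʳ i)) (≡.trans (from-cong to-i≈to-j) (strictlyInverseʳ j))

  infix 4 _≈?_
  _≈?_ : Decidable _≈_
  x ≈? y = map′ from-injective from-cong (from x Fin.≟ from y)

  infix 4 _∈?_
  _∈?_ : ∀ x I → Dec (x ∈ I)
  x ∈? I = I x Bool.≟ true

  zeroIdeal : Subset R
  zeroIdeal x = does (x ≈? 0#)

  zeroIdeal-isIdeal : IsIdeal R zeroIdeal
  zeroIdeal-isIdeal = record
    { resp     = λ x≈y → Bool.⇔→≡ (mk⇔ (≈0⇒∈ ∘ trans (sym x≈y) ∘ ∈⇒≈0) (≈0⇒∈ ∘ trans x≈y ∘ ∈⇒≈0))
    ; zero∈    = ≈0⇒∈ refl
    ; +-closed = λ x∈ y∈ → ≈0⇒∈ (trans (+-cong (∈⇒≈0 x∈) (∈⇒≈0 y∈)) (+-identityʳ 0#))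
    ; *-closed = λ r x∈ → ≈0⇒∈ (trans (*-congˡ (∈⇒≈0 x∈)) (zeroʳ r))
    }
    where
    ≈0⇒∈ : ∀ {x} → x ≈ 0# → x ∈ zeroIdeal
    ≈0⇒∈ {x} = dec-true (x ≈? 0#)

    ∈⇒≈0 : ∀ {x} → x ∈ zeroIdeal → x ≈ 0#
    ∈⇒≈0 {x} = does⇒ (x ≈? 0#)

  -- The ideal I + (a), as a Boolean subset: the multiplier r is searched along the enumeration.
  adjoin : Subset R → Carrier → Subset R
  adjoin I a x = does (Fin.any? λ j → x - a * to j ∈? I)

  module Adjoin {I : Subset R} (isI : IsIdeal R I) (a : Carrier) where
    open IsIdeal isI
    open Ideal isI

    adjoin-intro : ∀ {x} r → x ≋ a * r mod I → x ∈ adjoin I a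
    adjoin-intro {x} r x≋ar =
      dec-true (Fin.any? _) (from r , ≋-trans x≋ar (≋-reflexive (*-congˡ (sym (to∘from r)))))

    adjoin-elim : ∀ {x} → x ∈ adjoin I a → ∃ λ r → x ≋ a * r mod I
    adjoin-elim {x} x∈ with does⇒ (Fin.any? λ j → x - a * to j ∈? I) x∈
    ... | j , x≋ = to j , x≋

    I⊆adjoin : I ⊆ adjoin I a
    I⊆adjoin x x∈I = adjoin-intro 0# (≋-trans (∈⇒≋0 x∈I) (≋-reflexive (sym (zeroʳ a))))

    a∈adjoin : a ∈ adjoin I a
    a∈adjoin = adjoin-intro 1# (≋-reflexive (sym (*-identityʳ a)))

    adjoin-isIdeal : IsIdeal R (adjoin I a)
    adjoin-isIdeal = record
      { resp     = λ x≈y → Bool.⇔→≡ (mk⇔ (transport (sym x≈y)) (transport x≈y))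
      ; zero∈    = I⊆adjoin 0# zero∈
      ; +-closed = λ x∈ y∈ → closed-+ (adjoin-elim x∈) (adjoin-elim y∈)
      ; *-closed = λ t x∈ → closed-* t (adjoin-elim x∈)
      }
      where
      transport : ∀ {x y} → y ≈ x → x ∈ adjoin I a → y ∈ adjoin I a
      transport y≈x x∈ with adjoin-elim x∈
      ... | r , x≋ar = adjoin-intro r (≋-trans (≋-reflexive y≈x) x≋ar)

      closed-+ : ∀ {x y} → (∃ λ r → x ≋ a * r mod I) → (∃ λ s → y ≋ a * s mod I) → x + y ∈ adjoin I a
      closed-+ (r , x≋ar) (s , y≋as) =
        adjoin-intro (r + s) (≋-trans (≋-+ x≋ar y≋as) (≋-reflexive (sym (distribˡ a r s))))

      closed-* : ∀ t {x} → (∃ λ r → x ≋ a * r mod I) → t * x ∈ adjoin I a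
      closed-* t (r , x≋ar) = adjoin-intro (t * r) (≋-trans (≋-* ≋-refl x≋ar) (≋-reflexive (x∙yz≈y∙xz t a r)))

    adjoin-least : ∀ {J} → IsIdeal R J → I ⊆ J → a ∈ J → adjoin I a ⊆ J
    adjoin-least isJ I⊆J a∈J x x∈ with adjoin-elim x∈
    ... | r , x≋ar = Ideal.∈-resp-≋ isJ (Ideal.≋-sym isJ (I⊆J _ x≋ar)) (Ideal.*ʳ-closed isJ r a∈J)

  zeroDivisor? : ∀ x → Dec (ZeroDiv R x)
  zeroDivisor? x = map′ (λ (j , witness) → to j , witness) pull
                        (Fin.any? λ j → ¬? (to j ≈? 0#) ×-dec (x * to j ≈? 0#))
    where
    pull : ZeroDiv R x → ∃ λ j → ¬ to j ≈ 0# × x * to j ≈ 0#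
    pull (y , y≉0 , xy≈0) = from y , y≉0 ∘ trans (sym (to∘from y)) , trans (*-congˡ (to∘from y)) xy≈0

  -- Multiplication by a regular element is injective, hence onto on the finite carrier.
  regular⇒invertible : ∀ {x} → Regular R x → ∃ λ r → x * r ≈ 1#
  regular⇒invertible {x} regular =
    let j , xj≡1 = injective⇒surjective (λ j → from (x * to j)) scale-injective (from 1#)
    in  to j , from-injective xj≡1
    where
    cancel : ∀ {a b} → x * a ≈ x * b → a ≈ b
    cancel {a} {b} xa≈xb = decidable-stable (a ≈? b) λ a≉b →
      regular (a - b , a≉b ∘ x∙y⁻¹≈ε⇒x≈y a b , trans (x[y-z]≈xy-xz x a b) (x≈y⇒x∙y⁻¹≈ε xa≈xb))

    scale-injective : Injective _≡_ _≡_ (λ j → from (x * to j))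
    scale-injective eq = to-injective (cancel (from-injective eq))

  size : Subset R → ℕ
  size I = FinSubset.∣ Vec.tabulate (I ∘ to) ∣

  size≤n : ∀ I → size I ≤ n
  size≤n I = FinSubset.∣p∣≤n (Vec.tabulate (I ∘ to))

  ⊆-or-escapes : ∀ {I J} → IsIdeal R I → IsIdeal R J → J ⊆ I ⊎ ∃ λ j → to j ∈ J × ¬ to j ∈ I
  ⊆-or-escapes {I} {J} isI isJ with Fin.any? (λ j → to j ∈? J ×-dec ¬? (to j ∈? I))
  ... | yes escapes = inj₂ escapes
  ... | no J⊆I = inj₁ λ x x∈J → Ideal.∈-resp-≈ isI (to∘from x) (decidable-stable (_ ∈? I) λ x∉I →
                   J⊆I (from x , Ideal.∈-resp-≈ isJ (sym (to∘from x)) x∈J , x∉I))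

  adjoin-grows : ∀ {I} → IsIdeal R I → ∀ j → ¬ to j ∈ I → size I < size (adjoin I (to j))
  adjoin-grows isI j j∉I = FinSubset.p⊂q⇒∣p∣<∣q∣
    ( (λ i∈I → ∈-tabulate⁺ (I⊆adjoin _ (∈-tabulate⁻ i∈I)))
    , j , ∈-tabulate⁺ a∈adjoin , j∉I ∘ ∈-tabulate⁻ )
    where open Adjoin isI (to j)

  maximal-or-extends : ∀ {I} → IsIdeal R I → ¬ 1# ∈ I →
                       IsMaximal R I ⊎ ∃ λ j → ¬ to j ∈ I × ¬ 1# ∈ adjoin I (to j)
  maximal-or-extends {I} isI 1∉I with Fin.any? (λ j → ¬? (to j ∈? I) ×-dec ¬? (1# ∈? adjoin I (to j)))
  ... | yes extends = inj₂ extends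
  ... | no stuck = inj₁ record { ideal = isI ; proper = 1∉I ; maximal = maximal }
    where
    maximal : ∀ J → IsIdeal R J → I ⊆ J → J ⊆ I ⊎ 1# ∈ J
    maximal J isJ I⊆J with ⊆-or-escapes isI isJ
    ... | inj₁ J⊆I             = inj₁ J⊆I
    ... | inj₂ (j , j∈J , j∉I) = inj₂ (Adjoin.adjoin-least isI (to j) isJ I⊆J j∈J 1#
                                       (decidable-stable (1# ∈? adjoin I (to j)) λ 1∉ → stuck (j , j∉I , 1∉)))

  -- Each enlargement raises size, which never exceeds n; slack counts the enlargements still possible.
  maximalAbove : ∀ {I} → IsIdeal R I → ¬ 1# ∈ I → ∃ λ M → IsMaximal R M × I ⊆ M
  maximalAbove = climb n (ℕ.m≤m+n n _)
    where
    climb : ∀ slack {I} → n ≤ slack ℕ.+ size I → IsIdeal R I → ¬ 1# ∈ I → ∃ λ M → IsMaximal R M × I ⊆ M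
    climb slack {I} bound isI 1∉I with maximal-or-extends isI 1∉I
    ... | inj₁ isMax = I , isMax , λ _ x∈I → x∈I
    climb zero    {I} bound isI 1∉I | inj₂ (j , j∉I , _) =
      contradiction bound (ℕ.<⇒≱ (ℕ.<-≤-trans (adjoin-grows isI j j∉I) (size≤n (adjoin I (to j)))))
    climb (suc s) {I} bound isI 1∉I | inj₂ (j , j∉I , 1∉I′) =
      let M , isMax , I′⊆M = climb s bound′ adjoin-isIdeal 1∉I′
      in  M , isMax , λ x x∈I → I′⊆M x (I⊆adjoin x x∈I)
      where
      open Adjoin isI (to j)
      bound′ : n ≤ s ℕ.+ size (adjoin I (to j))
      bound′ = ℕ.≤-trans bound (ℕ.≤-trans (ℕ.≤-reflexive (≡.sym (ℕ.+-suc s (size I))))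
                                           (ℕ.+-monoʳ-≤ s (adjoin-grows isI j j∉I)))

  noninvertible⇒∈maximal : ∀ {z} → (∀ r → ¬ z * r ≈ 1#) → ∃ λ M → IsMaximal R M × z ∈ M
  noninvertible⇒∈maximal {z} noninvertible =
    let M , isMax , ⟨z⟩⊆M = maximalAbove adjoin-isIdeal 1∉⟨z⟩ in M , isMax , ⟨z⟩⊆M z a∈adjoin
    where
    open Adjoin zeroIdeal-isIdeal z

    1∉⟨z⟩ : ¬ 1# ∈ adjoin zeroIdeal z
    1∉⟨z⟩ 1∈ = let r , 1≋zr = adjoin-elim 1∈
               in  noninvertible r (sym (x∙y⁻¹≈ε⇒x≈y 1# (z * r) (does⇒ (_ ≈? 0#) 1≋zr)))

  zeroDivisor⇒∈maximal : ∀ {z} → ZeroDiv R z → ∃ λ M → IsMaximal R M × z ∈ M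
  zeroDivisor⇒∈maximal zd = noninvertible⇒∈maximal λ r → zeroDivisor⇒¬invertible zd

  leastIndex : Subset R → Carrier → Maybe (Fin n)
  leastIndex I x = firstTrue λ j → I (to j - x)

  -- Which of the cosets x + I and -x + I has the smaller least index.
  side : Subset R → Carrier → Fin 2
  side I x = orient (leastIndex I x) (leastIndex I (- x))

  module Maximal {M : Subset R} (isMax : IsMaximal R M) where
    open IsMaximal isMax
    open Ideal ideal

    ∈⇒zeroDivisor : ∀ {x} → x ∈ M → ZeroDiv R x
    ∈⇒zeroDivisor {x} x∈M = decidable-stable (zeroDivisor? x) λ regular →
      let r , xr≈1 = regular⇒invertible regular in proper (∈-resp-≈ xr≈1 (*ʳ-closed r x∈M))

    invertibleModulo : ∀ {x} → ¬ x ∈ M → ∃ λ r → x * r ≋ 1# mod M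
    invertibleModulo {x} x∉M =
      [ (λ ⟨M,x⟩⊆M → contradiction (⟨M,x⟩⊆M x a∈adjoin) x∉M)
      , (λ 1∈ → let r , 1≋xr = adjoin-elim 1∈ in r , ≋-sym 1≋xr)
      ]′ (maximal (adjoin M x) adjoin-isIdeal I⊆adjoin)
      where open Adjoin ideal x

    x+x∉ : ¬ 1# + 1# ∈ M → ∀ {x} → ¬ x ∈ M → ¬ x + x ∈ M
    x+x∉ 2∉M {x} x∉M x+x∈M =
      let r , xr≋1 = invertibleModulo x∉M
      in  2∉M (≋0⇒∈ (≋-trans (≋-sym (≋-+ xr≋1 xr≋1))
                    (≋-trans (≋-reflexive (sym (distribʳ r x x)))
                    (≋-trans (≋-* (∈⇒≋0 x+x∈M) ≋-refl) (≋-reflexive (zeroˡ r))))))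

    leastIndex-cong : ∀ {x y} → x ≋ y mod M → leastIndex M x ≡ leastIndex M y
    leastIndex-cong x≋y = firstTrue-cong λ j → membership-resp-≋ (≋-+ ≋-refl (≋-neg x≋y))

    leastIndex-just : ∀ x → ∃ λ a → leastIndex M x ≡ just a
    leastIndex-just x = firstTrue-complete _ (≋-reflexive (to∘from x))

    leastIndex-≋ : ∀ {x a} → leastIndex M x ≡ just a → to a ≋ x mod M
    leastIndex-≋ = firstTrue-sound _

    -- y ≡ -x (mod M) swaps the two cosets, and they differ because 2x ∉ M.
    side-flip : ¬ 1# + 1# ∈ M → ∀ {x y} → ¬ x ∈ M → x + y ∈ M → side M x ≢ side M y
    side-flip 2∉M {x} {y} x∉M x+y∈M same with leastIndex-just x | leastIndex-just (- x)
    ... | a , least-x | b , least-−x = order-swap a≢b (≡.trans (≡.sym side-x) (≡.trans same side-y))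
      where
      y≋−x : y ≋ - x mod M
      y≋−x = ∈-resp-≈ (trans (+-comm x y) (+-congˡ (sym (⁻¹-involutive x)))) x+y∈M

      −y≋x : - y ≋ x mod M
      −y≋x = ≋-trans (≋-neg y≋−x) (≋-reflexive (⁻¹-involutive x))

      side-x : side M x ≡ order a b
      side-x = ≡.cong₂ orient least-x least-−x

      side-y : side M y ≡ order b a
      side-y = ≡.cong₂ orient (≡.trans (leastIndex-cong y≋−x) least-−x) (≡.trans (leastIndex-cong −y≋x) least-x)

      a≢b : a ≢ b
      a≢b ≡.refl = x+x∉ 2∉M x∉M (∈-resp-≈ (+-congˡ (⁻¹-involutive x))
                     (≋-trans (≋-sym (leastIndex-≋ least-x)) (leastIndex-≋ least-−x)))

  module Spectrum {k} (M : Fin k → Subset R) (isMax : ∀ i → IsMaximal R (M i))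
                  (distinct : ∀ i j → SameSet R (M i) (M j) → i ≡ j)
                  (exhaustive : ∀ I → IsMaximal R I → ∃ λ i → SameSet R I (M i))
                  (2∉ : ∀ i → ¬ 1# + 1# ∈ M i) where

    isIdeal : ∀ i → IsIdeal R (M i)
    isIdeal i = IsMaximal.ideal (isMax i)

    zeroDivisor⇒∈some : ∀ {z} → ZeroDiv R z → ∃ λ i → z ∈ M i
    zeroDivisor⇒∈some zd =
      let I , isMaxI , z∈I = zeroDivisor⇒∈maximal zd
          i , I≡Mi         = exhaustive I isMaxI
      in  i , ≡.trans (≡.sym (I≡Mi _)) z∈I

    regular⇒∉ : ∀ {x} → Regular R x → ∀ i → ¬ x ∈ M i
    regular⇒∉ regular i = regular ∘ Maximal.∈⇒zeroDivisor (isMax i)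

    ∉⇒regular : ∀ {x} → (∀ i → ¬ x ∈ M i) → Regular R x
    ∉⇒regular ∉M zd = let i , x∈Mi = zeroDivisor⇒∈some zd in ∉M i x∈Mi

    colouring : ProperColouring R (2 ^ k)
    colouring = colour , proper
      where
      colour : Carrier → Fin (2 ^ k)
      colour x = funToFin λ i → side (M i) x

      proper : ∀ x y → Regular R x → Regular R y → Adj R x y → colour x ≢ colour y
      proper x y regular-x _ (_ , zd) same =
        let i , x+y∈Mi = zeroDivisor⇒∈some zd
        in  Maximal.side-flip (isMax i) (2∉ i) (regular⇒∉ regular-x i) x+y∈Mi (funToFin-injective same i)

    separator : ∀ {i j} → i ≢ j → ∃ λ a → a ∈ M j × a ≋ 1# mod M i
    separator {i} {j} i≢j with ⊆-or-escapes (isIdeal i) (isIdeal j)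
    ... | inj₂ (t , t∈Mj , t∉Mi) =
      let r , tr≋1 = Maximal.invertibleModulo (isMax i) t∉Mi
      in  to t * r , Ideal.*ʳ-closed (isIdeal j) r t∈Mj , tr≋1
    ... | inj₁ Mj⊆Mi with IsMaximal.maximal (isMax j) (M i) (isIdeal i) Mj⊆Mi
    ...   | inj₁ Mi⊆Mj = contradiction (distinct i j (⊆-antisym Mi⊆Mj Mj⊆Mi)) i≢j
    ...   | inj₂ 1∈Mi  = contradiction 1∈Mi (IsMaximal.proper (isMax i))

    factor : Fin k → Fin k → Carrier
    factor i j with i Fin.≟ j
    ... | yes _   = 1#
    ... | no i≢j = proj₁ (separator i≢j)

    factor-≋1 : ∀ i j → factor i j ≋ 1# mod M i
    factor-≋1 i j with i Fin.≟ j
    ... | yes _   = Ideal.≋-refl (isIdeal i)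
    ... | no i≢j = proj₂ (proj₂ (separator i≢j))

    factor-∈ : ∀ {i j} → i ≢ j → factor i j ∈ M j
    factor-∈ {i} {j} i≢j with i Fin.≟ j
    ... | yes i≡j  = contradiction i≡j i≢j
    ... | no i≢j′ = proj₁ (proj₂ (separator i≢j′))

    -- A lift of the i-th idempotent of R/M₀ × … × R/M_{k-1}.
    indicator : Fin k → Carrier
    indicator i = product (factor i)

    vertex : (Fin k → Fin 2) → Carrier
    vertex s = sum λ i → sign (s i) * indicator i

    vertex-≋ : ∀ s i → vertex s ≋ sign (s i) mod M i
    vertex-≋ s i = sum-≋-single _ i
      (≋-trans (≋-* ≋-refl (product-≋1 (factor i) (factor-≋1 i))) (≋-reflexive (*-identityʳ _)))
      (λ j j≢i → *-closed (sign (s j)) (Ideal.product-∈ (isIdeal i) (factor j) i (factor-∈ j≢i)))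
      where
      open Ideal (isIdeal i)
      open IsIdeal (isIdeal i)

    vertex∉ : ∀ s i → ¬ vertex s ∈ M i
    vertex∉ s i = sign∉ (IsMaximal.proper (isMax i)) (s i) ∘ ∈-resp-≋ (vertex-≋ s i)
      where open Ideal (isIdeal i)

    vertex-adjacent : ∀ {s t} i → s i ≢ t i → Adj R (vertex s) (vertex t)
    vertex-adjacent {s} {t} i sᵢ≢tᵢ =
      (λ vs≈vt → Maximal.x+x∉ (isMax i) (2∉ i) (vertex∉ s i) (∈-resp-≈ (+-congˡ (sym vs≈vt)) sum∈Mi)) ,
      Maximal.∈⇒zeroDivisor (isMax i) sum∈Mi
      where
      open Ideal (isIdeal i)
      sum∈Mi : vertex s + vertex t ∈ M i
      sum∈Mi = ≋0⇒∈ (≋-trans (≋-+ (vertex-≋ s i) (vertex-≋ t i)) (≋-reflexive (sign-opposite sᵢ≢tᵢ)))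

    clique : Clique R (2 ^ k)
    clique = vertex ∘ finToFun , (λ a → ∉⇒regular (vertex∉ (finToFun a))) , injective , adjacent
      where
      adjacent : ∀ a b → a ≢ b → Adj R (vertex (finToFun a)) (vertex (finToFun b))
      adjacent a b a≢b =
        let i , differ = Fin.¬∀⟶∃¬ k _ (λ i → finToFun a i Fin.≟ finToFun b i) (a≢b ∘ finToFun-injective)
        in  vertex-adjacent {finToFun a} {finToFun b} i differ

      injective : ∀ a b → vertex (finToFun a) ≈ vertex (finToFun b) → a ≡ b
      injective a b same with a Fin.≟ b
      ... | yes a≡b = a≡b
      ... | no a≢b  = contradiction same (proj₁ (adjacent a b a≢b))

mainTheorem7 : ∀ {c ℓ} (R : CommutativeRing c ℓ) → Finite R
    → ¬ (CommutativeRing._≈_ R (CommutativeRing.1# R) (CommutativeRing.0# R))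
    → (∀ M → IsMaximal R M → ∀ n → IsCharOf R M n → Odd n)
    → ∀ k → NumMaximal R k
    → ChromaticNumberReg R (2 ^ k) × CliqueNumberReg R (2 ^ k)
mainTheorem7 R (n , enum) _ odd k (M , isMax , distinct , exhaustive) =
  colouring×clique⇒χ≡ω R colouring clique
  where
  open FiniteRing R enum
  open Spectrum M isMax distinct exhaustive
    (λ i → Ideals.oddCharacteristic⇒2∉ R (isMax i) (odd (M i) (isMax i)))
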